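{- Let $k \ge 1$ and $m, n \ge 2$. If $m \equiv 0 \pmod{k+1}$ or $n \equiv 0 \pmod{k+1}$, then $d_k(P_m \Box P_n) = \frac{mn}{k+1}$.
   Context: $P_n$ is the path on $n$ vertices; $P_m \Box P_n$ is the Cartesian product ($m\times n$ grid): vertices $(i,j)$, $0\le i\le m-1$, $0\le j\le n-1$, with $(i,j)$ adjacent to $(i',j')$ iff ($|i-i'|=1$ and $j=j'$) or ($i=i'$ and $|j-j'|=1$). The $k$-move deduction game ($k$ a positive integer) on a finite graph $G$: a layout places a finite number of searchers on vertices of $G$ (several searchers may share a vertex). Every searcher is initially mobile. A vertex is protected once it has been occupied by some searcher (so initially occupied vertices are protected); other vertices are unprotected. The game proceeds in stages. At each stage, for every vertex $v$ that has at least one unprotected neighbour: if the number of mobile searchers on $v$ is at least the number of unprotected neighbours of $v$, then the mobile searchers on $v$ move to the unprotected neighbours of $v$ so that each unprotected neighbour receives at least one searcher; excess mobile searchers on $v$ may also move to any of these unprotected neighbours. All moves in a stage happen simultaneously, newly occupied vertices become protected, and a searcher that has moved $k$ times becomes immobile. The process repeats until all vertices are protected or no searcher can move. A layout is successful if all vertices of $G$ end up protected. The $k$-move deduction number $d_k(G)$ is the minimum number of searchers in a successful layout on $G$. -}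

module Defs where

open import Data.Bool using (Bool; true; false; _∧_; _∨_; not; T)
open import Data.Nat using (ℕ; zero; suc; _≡ᵇ_; _<ᵇ_; _≤ᵇ_)
open import Data.Fin using (Fin; toℕ)
open import Data.Fin.Properties using () renaming (_≟_ to _≟F_)
open import Data.Product using (_×_; _,_; proj₁; proj₂; Σ; ∃)
open import Data.List using (List; []; _∷_; map; length; filterᵇ; allFin; cartesianProduct; zip)
open import Data.Bool.ListAction using (any)
open import Data.List.Relation.Binary.Pointwise using (Pointwise)
open import Data.List.Relation.Unary.Any using (Any)
open import Data.List.Membership.Propositional using (_∈_)
open import Relation.Binary.Construct.Closure.ReflexiveTransitive using (Star)
open import Relation.Binary.PropositionalEquality using (_≡_)
open import Relation.Nullary.Decidable using (⌊_⌋)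

Vtx : ℕ → ℕ → Set
Vtx m n = Fin m × Fin n

verts : (m n : ℕ) → List (Vtx m n)
verts m n = cartesianProduct (allFin m) (allFin n)

eqV : ∀ {m n} → Vtx m n → Vtx m n → Bool
eqV (i , j) (i' , j') = ⌊ i ≟F i' ⌋ ∧ ⌊ j ≟F j' ⌋

dist1 : ℕ → ℕ → Bool
dist1 a b = (suc a ≡ᵇ b) ∨ (suc b ≡ᵇ a)

adj : ∀ {m n} → Vtx m n → Vtx m n → Bool
adj (i , j) (i' , j') =
  (dist1 (toℕ i) (toℕ i') ∧ ⌊ j ≟F j' ⌋) ∨ (⌊ i ≟F i' ⌋ ∧ dist1 (toℕ j) (toℕ j'))

-- a searcher: its current vertex and the number of moves it has made
Searcher : ℕ → ℕ → Set
Searcher m n = Vtx m n × ℕ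

-- game state: list of searchers and the set of protected vertices
State : ℕ → ℕ → Set
State m n = List (Searcher m n) × (Vtx m n → Bool)

unprot : ∀ {m n} → (Vtx m n → Bool) → Vtx m n → List (Vtx m n)
unprot {m} {n} P v = filterᵇ (λ u → adj v u ∧ not (P u)) (verts m n)

mobile : ∀ {m n} → ℕ → Searcher m n → Bool
mobile k (_ , c) = c <ᵇ k

nMobile : ∀ {m n} → ℕ → List (Searcher m n) → Vtx m n → ℕ
nMobile k ps v = length (filterᵇ (λ s → eqV (proj₁ s) v ∧ mobile k s) ps)

fires : ∀ {m n} → ℕ → State m n → Vtx m n → Bool
fires k (ps , P) v =
  (0 <ᵇ length (unprot P v)) ∧ (length (unprot P v) ≤ᵇ nMobile k ps v)

SMove : ∀ {m n} → ℕ → State m n → Searcher m n → Searcher m n → Set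
SMove k st@(ps , P) (v , c) (v' , c') with mobile k (v , c) ∧ fires k st v
... | true  = (adj v v' ≡ true) × (P v' ≡ false) × (c' ≡ suc c)
... | false = (v' ≡ v) × (c' ≡ c)

newProt : ∀ {m n} → (Vtx m n → Bool) → List (Searcher m n) → Vtx m n → Bool
newProt P ps' u = P u ∨ any (λ s → eqV (proj₁ s) u) ps'

-- one stage of the game (nondeterministic in how searchers are distributed)
data Step {m n : ℕ} (k : ℕ) : State m n → State m n → Set where
  step : ∀ {ps P} (ps' : List (Searcher m n)) →
         Pointwise (SMove k (ps , P)) ps ps' →
         -- every unprotected neighbour of a firing vertex receives a searcher from it
         (∀ v u → fires k (ps , P) v ≡ true → u ∈ unprot P v →
            Any (λ ss → (proj₁ (proj₁ ss) ≡ v) × (proj₁ (proj₂ ss) ≡ u) × (mobile k (proj₁ ss) ≡ true))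
                (zip ps ps')) →
         Step k (ps , P) (ps' , newProt P ps')

-- initial state of a layout (a finite list of searcher positions, repetitions allowed)
initState : ∀ {m n} → List (Vtx m n) → State m n
initState L = map (λ v → (v , 0)) L , (λ u → any (λ v → eqV v u) L)

AllProtected : ∀ {m n} → State m n → Set
AllProtected {m} {n} (_ , P) = ∀ (u : Vtx m n) → P u ≡ true

Successful : (k m n : ℕ) → List (Vtx m n) → Set
Successful k m n L = ∃ λ (st : State m n) → Star (Step k) (initState L) st × AllProtected st

IsDeductionNumber : (k m n d : ℕ) → Set
IsDeductionNumber k m n d =
  (∃ λ (L : List (Vtx m n)) → length L ≡ d × Successful k m n L) ×
  (∀ (L : List (Vtx m n)) → Successful k m n L → d Data.Nat.≤ length L)

-- Lower bound: a searcher that moves c times protects at most c + 1 vertices, and it moves at most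
-- k times, so a successful layout L protects at most |L| (k + 1) vertices; hence |L| ≥ mn / (k + 1).
--
-- Upper bound: say k + 1 divides m.  Cut every line of length m of the grid into blocks of k + 1
-- consecutive vertices and start one searcher at an end of each block: at the left end in even
-- blocks, at the right end in odd ones.  The searchers of two neighbouring blocks then either start
-- next to each other or walk towards their common boundary, and parallel lines move in lockstep, so
-- at every stage each searcher has exactly one unprotected neighbour, the next vertex of its block.
-- After k stages every vertex is protected, using exactly mn / (k + 1) searchers.
module Submission where

open import Defs
import Algebra.Properties.CommutativeSemigroup as CommutativeSemigroupProperties
open import Data.Bool using (Bool; true; false; T?; not; _∧_; _∨_)
open import Data.Bool.ListAction using (any)
open import Data.Bool.Properties using (T-≡; T-not-≡; T-∧; T-∨; ∧-conicalˡ; ∧-conicalʳ; ∨-zeroʳ)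
open import Data.Fin using (Fin; toℕ; fromℕ<; combine; remQuot)
open import Data.Fin.Properties
  using (_≟_; injective⇒≤; combine-remQuot; toℕ<n; toℕ-fromℕ<; toℕ-injective)
open import Data.List using (List; []; _∷_; _++_; map; length; filterᵇ; zip; lookup; allFin; cartesianProduct)
open import Data.List.Properties using (length-map; length-++; length-tabulate; map-∘; filter-some)
open import Data.List.Membership.Propositional using (_∈_; find; lose)
open import Data.List.Membership.Propositional.Properties
  using (∈-allFin; ∈-cartesianProduct⁺; ∈-filter⁻; ∈-map⁺; ∈-map⁻)
open import Data.List.Relation.Binary.Pointwise as Pointwise using (Pointwise; []; _∷_; Pointwise-length)
open import Data.List.Relation.Unary.All as All using (All; []; _∷_)
import Data.List.Relation.Unary.All.Properties as All
open import Data.List.Relation.Unary.AllPairs using ([]; _∷_)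
open import Data.List.Relation.Unary.Any using (Any; here; there; index)
open import Data.List.Relation.Unary.Any.Properties using (lookup-index; any⁺; any⁻; ++⁺ʳ)
open import Data.List.Relation.Unary.Unique.Propositional using (Unique)
import Data.List.Relation.Unary.Unique.Propositional.Properties as Unique
open import Data.Nat
  using (ℕ; zero; suc; _+_; _*_; _∸_; _⊓_; _/_; _%_; _≤_; _<_; _≡ᵇ_; z≤n; s≤s; s≤s⁻¹; NonZero)
open import Data.Nat.Divisibility using (_∣_; divides)
open import Data.Nat.DivMod
  using (m*n/n≡m; /-monoˡ-≤; [m+kn]%n≡m%n; m<n⇒m%n≡m; m%n<n; m≡m%n+[m/n]*n; m<n*o⇒m/o<n)
open import Data.Nat.ListAction using (sum)
open import Data.Nat.Properties
  using ( +-comm; +-suc; +-identityʳ; +-cancelʳ-≡; +-mono-≤; +-monoʳ-≤; +-monoʳ-<; +-∸-assoc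
        ; *-suc; *-cancelʳ-≡; *-cancelʳ-<; *-monoˡ-≤; +-commutativeSemigroup; *-commutativeSemigroup
        ; ≤-refl; ≤-reflexive; ≤-trans; ≤-antisym; <-trans; ≤-<-trans; <-≤-trans; <⇒≤; <⇒≱
        ; n≤1+n; n<1+n; m≤m+n; m≤n⇒m≤1+n; m≤n⇒m<n∨m≡n; suc-injective
        ; m∸n≤m; m∸[m∸n]≡n; ∸-cancelˡ-≡; m⊓n≤n; m≤n⇒m⊓n≡m
        ; ≡ᵇ⇒≡; ≡⇒≡ᵇ; <ᵇ⇒<; <⇒<ᵇ; ≤ᵇ⇒≤; ≤⇒≤ᵇ; module ≤-Reasoning )
open import Data.Product using (_×_; _,_; proj₁; proj₂; ∃; uncurry)
open import Data.Sum as Sum using (_⊎_; inj₁; inj₂)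
open import Function using (_∘_; id; Injective; Equivalence)
open import Relation.Binary.Construct.Closure.ReflexiveTransitive using (Star; ε; _◅_; _◅◅_)
open import Relation.Binary.PropositionalEquality
open import Relation.Nullary using (¬_; contradiction)
open import Relation.Nullary.Decidable using (⌊_⌋; toWitness; fromWitness)

open Equivalence using (to; from)
module +-Properties = CommutativeSemigroupProperties +-commutativeSemigroup
module *-Properties = CommutativeSemigroupProperties *-commutativeSemigroup

private
  variable
    k m n : ℕ

∈-injective⇒≤length : ∀ {N} {A : Set} {g : Fin N → A} {H : List A} →
                      Injective _≡_ _≡_ g → (∀ x → g x ∈ H) → N ≤ length H
∈-injective⇒≤length {g = g} {H} g-injective g∈H = injective⇒≤ index-injective
  where
  index-injective : ∀ {x y} → index (g∈H x) ≡ index (g∈H y) → x ≡ y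
  index-injective {x} {y} eq = g-injective (begin
    g x                       ≡⟨ lookup-index (g∈H x) ⟩
    lookup H (index (g∈H x))  ≡⟨ cong (lookup H) eq ⟩
    lookup H (index (g∈H y))  ≡⟨ lookup-index (g∈H y) ⟨
    g y                       ∎)
    where open ≡-Reasoning

remQuot-injective : Injective _≡_ _≡_ (remQuot {m} n)
remQuot-injective {m} {n} {x} {y} eq =
  trans (sym (combine-remQuot {m} n x)) (trans (cong (uncurry combine) eq) (combine-remQuot {m} n y))

unique-constant⇒length≤1 : {A : Set} {x : A} {ys : List A} → Unique ys → All (_≡ x) ys → length ys ≤ 1
unique-constant⇒length≤1 []                []                 = z≤n
unique-constant⇒length≤1 (_ ∷ [])          _                  = ≤-refl
unique-constant⇒length≤1 ((y≢z ∷ _) ∷ _)   (refl ∷ refl ∷ _)  = contradiction refl y≢z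

length-filterᵇ≡1 : {A : Set} (p : A → Bool) {x : A} {xs : List A} → Unique xs → x ∈ xs →
                   p x ≡ true → (∀ y → p y ≡ true → y ≡ x) → length (filterᵇ p xs) ≡ 1
length-filterᵇ≡1 p {xs = xs} xs-unique x∈xs px only-x = ≤-antisym
  (unique-constant⇒length≤1 (Unique.filter⁺ (T? ∘ p) xs-unique)
    (All.tabulate λ y∈ → only-x _ (to T-≡ (proj₂ (∈-filter⁻ (T? ∘ p) {xs = xs} y∈)))))
  (filter-some (T? ∘ p) (lose x∈xs (from T-≡ px)))

0<length-filterᵇ⇒∃ : {A : Set} (p : A → Bool) (xs : List A) →
                     0 < length (filterᵇ p xs) → ∃ λ x → x ∈ xs × p x ≡ true
0<length-filterᵇ⇒∃ p xs _ with filterᵇ p xs in filtered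
... | y ∷ _ = let y∈xs , py = ∈-filter⁻ (T? ∘ p) (subst (y ∈_) (sym filtered) (here refl))
              in y , y∈xs , to T-≡ py

∈-zip-map : {A B C : Set} (f : A → B) (g : A → C) {x : A} {xs : List A} →
            x ∈ xs → (f x , g x) ∈ zip (map f xs) (map g xs)
∈-zip-map f g (here refl)  = here refl
∈-zip-map f g (there x∈xs) = there (∈-zip-map f g x∈xs)

length-cartesianProduct : {A B : Set} (xs : List A) (ys : List B) →
                          length (cartesianProduct xs ys) ≡ length xs * length ys
length-cartesianProduct []       ys = refl
length-cartesianProduct (x ∷ xs) ys = begin
  length (map (x ,_) ys ++ cartesianProduct xs ys)          ≡⟨ length-++ (map (x ,_) ys) ⟩
  length (map (x ,_) ys) + length (cartesianProduct xs ys)  ≡⟨ cong₂ _+_ (length-map (x ,_) ys)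
                                                                         (length-cartesianProduct xs ys) ⟩
  length ys + length xs * length ys                         ∎
  where open ≡-Reasoning

length-allFin : ∀ N → length (allFin N) ≡ N
length-allFin N = length-tabulate id

isYes-≟-refl : ∀ {N} (i : Fin N) → ⌊ i ≟ i ⌋ ≡ true
isYes-≟-refl i = to T-≡ (fromWitness refl)

eqV-refl : (v : Vtx m n) → eqV v v ≡ true
eqV-refl (i , j) = cong₂ _∧_ (isYes-≟-refl i) (isYes-≟-refl j)

eqV⇒≡ : {u v : Vtx m n} → eqV u v ≡ true → u ≡ v
eqV⇒≡ {u = i , j} {i′ , j′} same =
  let i≡i′ , j≡j′ = to T-∧ (from T-≡ same)
  in cong₂ _,_ (toWitness {a? = i ≟ i′} i≡i′) (toWitness {a? = j ≟ j′} j≡j′)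

any-eqV⇒∈ : {A : Set} (f : A → Vtx m n) (xs : List A) {u : Vtx m n} →
            any (λ x → eqV (f x) u) xs ≡ true → ∃ λ x → x ∈ xs × f x ≡ u
any-eqV⇒∈ f xs found = let x , x∈xs , fx≈u = find (any⁻ _ xs (from T-≡ found))
                       in x , x∈xs , eqV⇒≡ (to T-≡ fx≈u)

any-eqV-map⇒∈ : {A B : Set} (f : B → Vtx m n) (g : A → B) (xs : List A) {u : Vtx m n} →
                any (λ y → eqV (f y) u) (map g xs) ≡ true → ∃ λ x → x ∈ xs × f (g x) ≡ u
any-eqV-map⇒∈ f g xs found with _ , y∈ , refl ← any-eqV⇒∈ f (map g xs) found
  with x , x∈xs , refl ← ∈-map⁻ g y∈ = x , x∈xs , refl

∈⇒any-eqV : {A : Set} (f : A → Vtx m n) {xs : List A} {x : A} →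
            x ∈ xs → any (λ y → eqV (f y) (f x)) xs ≡ true
∈⇒any-eqV f x∈xs = to T-≡ (any⁺ _ (lose x∈xs (from T-≡ (eqV-refl (f _)))))

∈-verts : (u : Vtx m n) → u ∈ verts m n
∈-verts (i , j) = ∈-cartesianProduct⁺ (∈-allFin i) (∈-allFin j)

verts-unique : ∀ m n → Unique (verts m n)
verts-unique m n = Unique.cartesianProduct⁺ (Unique.allFin⁺ m) (Unique.allFin⁺ n)

vertices-cover⇒m*n≤length : (H : List (Vtx m n)) → (∀ u → u ∈ H) → m * n ≤ length H
vertices-cover⇒m*n≤length H all∈H = ∈-injective⇒≤length remQuot-injective (all∈H ∘ remQuot _)

dist1⁺ : ∀ {a b} → suc a ≡ b ⊎ suc b ≡ a → dist1 a b ≡ true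
dist1⁺ {a}     (inj₁ refl) rewrite to T-≡ (≡⇒≡ᵇ a a refl) = refl
dist1⁺ {b = b} (inj₂ refl) rewrite to T-≡ (≡⇒≡ᵇ b b refl) = ∨-zeroʳ _

dist1⁻ : ∀ a b → dist1 a b ≡ true → suc a ≡ b ⊎ suc b ≡ a
dist1⁻ a b close with suc a ≡ᵇ b in up
... | true  = inj₁ (≡ᵇ⇒≡ (suc a) b (from T-≡ up))
... | false = inj₂ (≡ᵇ⇒≡ (suc b) a (from T-≡ close))

adj⁻ : ∀ {i i′ : Fin m} {j j′ : Fin n} → adj (i , j) (i′ , j′) ≡ true →
       (dist1 (toℕ i) (toℕ i′) ≡ true × j ≡ j′) ⊎ (i ≡ i′ × dist1 (toℕ j) (toℕ j′) ≡ true)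
adj⁻ close with to T-∨ (from T-≡ close)
... | inj₁ vertical   = let i~i′ , j≡j′ = to T-∧ vertical   in inj₁ (to T-≡ i~i′ , toWitness j≡j′)
... | inj₂ horizontal = let i≡i′ , j~j′ = to T-∧ horizontal in inj₂ (toWitness i≡i′ , to T-≡ j~j′)

adj-vertical⁻ : ∀ {i i′ : Fin m} {j j′ : Fin n} → adj (i , j) (i′ , j′) ≡ true →
                (dist1 (toℕ i) (toℕ i′) ≡ true × j ≡ j′) ⊎ i ≡ i′
adj-vertical⁻ close with adj⁻ close
... | inj₁ vertical    = inj₁ vertical
... | inj₂ (i≡i′ , _)  = inj₂ i≡i′

adj-horizontal⁻ : ∀ {i i′ : Fin m} {j j′ : Fin n} → adj (i , j) (i′ , j′) ≡ true →
                  (dist1 (toℕ j) (toℕ j′) ≡ true × i ≡ i′) ⊎ j ≡ j′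
adj-horizontal⁻ close with adj⁻ close
... | inj₁ (_ , j≡j′)     = inj₂ j≡j′
... | inj₂ (i≡i′ , j~j′)  = inj₁ (j~j′ , i≡i′)

adj-vertical : ∀ {i i′ : Fin m} (j : Fin n) → dist1 (toℕ i) (toℕ i′) ≡ true →
               adj (i , j) (i′ , j) ≡ true
adj-vertical j close rewrite close | isYes-≟-refl j = refl

adj-horizontal : ∀ (i : Fin m) {j j′ : Fin n} → dist1 (toℕ j) (toℕ j′) ≡ true →
                 adj (i , j) (i , j′) ≡ true
adj-horizontal i close rewrite isYes-≟-refl i | close = ∨-zeroʳ _

smove⁻ : ∀ {st} {s s′ : Searcher m n} → SMove k st s s′ →
         s′ ≡ s ⊎ (proj₂ s < k × proj₂ s′ ≡ suc (proj₂ s))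
smove⁻ {k = k} {st = st} {s = v , c} moved with mobile k (v , c) ∧ fires k st v in active
smove⁻ {k = k} {s = v , c} (_ , _ , c′≡1+c) | true =
  inj₂ (<ᵇ⇒< c k (from T-≡ (∧-conicalˡ _ _ active)) , c′≡1+c)
smove⁻ (refl , refl) | false = inj₁ refl

smove⁺ : ∀ {ps P} {v v′ : Vtx m n} {c} → mobile k (v , c) ∧ fires k (ps , P) v ≡ true →
         adj v v′ ≡ true → P v′ ≡ false → SMove k (ps , P) (v , c) (v′ , suc c)
smove⁺ active adj-v′ fresh-v′ rewrite active = adj-v′ , fresh-v′ , refl

unprotected-neighbour⁻ : ∀ {P : Vtx m n → Bool} {v u} → adj v u ∧ not (P u) ≡ true →
                         adj v u ≡ true × P u ≡ false
unprotected-neighbour⁻ candidate =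
  ∧-conicalˡ _ _ candidate , to T-not-≡ (from T-≡ (∧-conicalʳ _ _ candidate))

∈-unprot⁻ : ∀ (P : Vtx m n → Bool) {v u} → u ∈ unprot P v → adj v u ≡ true × P u ≡ false
∈-unprot⁻ {m} {n} P {v} u∈ = unprotected-neighbour⁻ {P = P}
  (to T-≡ (proj₂ (∈-filter⁻ (T? ∘ λ w → adj v w ∧ not (P w)) {xs = verts m n} u∈)))

fires⇒0<nMobile : ∀ {st : State m n} {v} → fires k st v ≡ true → 0 < nMobile k (proj₁ st) v
fires⇒0<nMobile {k = k} {st = ps , P} {v} fires-v = <-≤-trans
  (<ᵇ⇒< 0 _ (from T-≡ (∧-conicalˡ _ _ fires-v)))
  (≤ᵇ⇒≤ (length (unprot P v)) (nMobile k ps v) (from T-≡ (∧-conicalʳ _ _ fires-v)))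

-- Lower bound

moves : List (Searcher m n) → ℕ
moves ps = sum (map proj₂ ps)

moves≤ : (ps : List (Searcher m n)) → All (λ s → proj₂ s ≤ k) ps → moves ps ≤ length ps * k
moves≤ []       []           = z≤n
moves≤ (_ ∷ ps) (c≤k ∷ cs≤k) = +-mono-≤ c≤k (moves≤ ps cs≤k)

record Footprint (k : ℕ) (L : List (Vtx m n)) (st : State m n) : Set where
  field
    visited    : List (Vtx m n)
    protected⊆ : ∀ u → proj₂ st u ≡ true → u ∈ visited
    positions⊆ : All (λ s → proj₁ s ∈ visited) (proj₁ st)
    visited≤   : length visited ≤ length L + moves (proj₁ st)
    moves≤k    : All (λ s → proj₂ s ≤ k) (proj₁ st)
    #searchers : length (proj₁ st) ≡ length L

footprint-init : (L : List (Vtx m n)) → Footprint k L (initState L)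
footprint-init L = record
  { visited    = L
  ; protected⊆ = λ u found → let x , x∈L , x≡u = any-eqV⇒∈ id L found in subst (_∈ L) x≡u x∈L
  ; positions⊆ = All.map⁺ (All.tabulate id)
  ; visited≤   = m≤m+n (length L) _
  ; moves≤k    = All.map⁺ (All.universal (λ _ → z≤n) L)
  ; #searchers = length-map _ L
  }

moved-positions : ∀ {st : State m n} (H : List (Vtx m n)) {xs ys} → Pointwise (SMove k st) xs ys →
  All (λ s → proj₁ s ∈ H) xs → All (λ s → proj₂ s ≤ k) xs →
  ∃ λ M → All (λ s → proj₁ s ∈ M ++ H) ys × All (λ s → proj₂ s ≤ k) ys
        × length M + moves xs ≡ moves ys
moved-positions H [] [] [] = [] , [] , [] , refl
moved-positions {k = k} {st = st} H {x ∷ xs} (x∼y ∷ xs∼ys) (x∈H ∷ xs∈H) (x≤k ∷ xs≤k)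
  with M , ys∈ , ys≤k , count ← moved-positions {st = st} H xs∼ys xs∈H xs≤k
     | smove⁻ {k = k} {st = st} x∼y
... | inj₁ refl         = M , ++⁺ʳ M x∈H ∷ ys∈ , x≤k ∷ ys≤k , shift
  where shift = trans (+-Properties.x∙yz≈y∙xz (length M) (proj₂ x) (moves xs)) (cong (proj₂ x +_) count)
... | inj₂ (x<k , refl) = _ ∷ M , here refl ∷ All.map there ys∈ , x<k ∷ ys≤k , cong suc shift
  where shift = trans (+-Properties.x∙yz≈y∙xz (length M) (proj₂ x) (moves xs)) (cong (proj₂ x +_) count)

footprint-step : ∀ {L} {st st′ : State m n} → Step k st st′ → Footprint k L st → Footprint k L st′
footprint-step {k = k} {L = L} {st = ps , P} (step ps′ ps∼ps′ _) fp
  with M , ps′∈ , ps′≤k , count ← moved-positions {st = ps , P} (Footprint.visited fp) ps∼ps′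
                                                  (Footprint.positions⊆ fp) (Footprint.moves≤k fp)
  = record
  { visited    = M ++ visited
  ; protected⊆ = protected⊆′
  ; positions⊆ = ps′∈
  ; visited≤   = visited≤′
  ; moves≤k    = ps′≤k
  ; #searchers = trans (sym (Pointwise-length ps∼ps′)) #searchers
  }
  where
  open Footprint fp
  protected⊆′ : ∀ u → newProt P ps′ u ≡ true → u ∈ M ++ visited
  protected⊆′ u new with P u in old
  ... | true  = ++⁺ʳ M (protected⊆ u old)
  ... | false = let s′ , s′∈ps′ , s′-at-u = any-eqV⇒∈ proj₁ ps′ new
                in subst (_∈ M ++ visited) s′-at-u (All.lookup ps′∈ s′∈ps′)
  visited≤′ : length (M ++ visited) ≤ length L + moves ps′
  visited≤′ = begin
    length (M ++ visited)             ≡⟨ length-++ M ⟩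
    length M + length visited         ≤⟨ +-monoʳ-≤ (length M) visited≤ ⟩
    length M + (length L + moves ps)  ≡⟨ +-Properties.x∙yz≈y∙xz (length M) (length L) (moves ps) ⟩
    length L + (length M + moves ps)  ≡⟨ cong (length L +_) count ⟩
    length L + moves ps′              ∎
    where open ≤-Reasoning

footprint-run : ∀ {L} {st st′ : State m n} → Star (Step k) st st′ → Footprint k L st → Footprint k L st′
footprint-run ε         fp = fp
footprint-run (s ◅ run) fp = footprint-run run (footprint-step s fp)

successful⇒m*n/[k+1]≤length : (L : List (Vtx m n)) → Successful k m n L → (m * n) / suc k ≤ length L
successful⇒m*n/[k+1]≤length {m} {n} {k} L (st , run , all-protected) = begin
  (m * n) / suc k             ≤⟨ /-monoˡ-≤ (suc k) m*n≤ ⟩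
  (length L * suc k) / suc k  ≡⟨ m*n/n≡m (length L) (suc k) ⟩
  length L                    ∎
  where
  open Footprint (footprint-run run (footprint-init {k = k} L))
  open ≤-Reasoning
  moves≤length*k : moves (proj₁ st) ≤ length L * k
  moves≤length*k = subst (λ l → moves (proj₁ st) ≤ l * k) #searchers (moves≤ (proj₁ st) moves≤k)
  m*n≤ : m * n ≤ length L * suc k
  m*n≤ = begin
    m * n                        ≤⟨ vertices-cover⇒m*n≤length visited (λ u → protected⊆ u (all-protected u)) ⟩
    length visited               ≤⟨ visited≤ ⟩
    length L + moves (proj₁ st)  ≤⟨ +-monoʳ-≤ (length L) moves≤length*k ⟩
    length L + length L * k      ≡⟨ *-suc (length L) k ⟨
    length L * suc k             ∎

-- Layouts following prescribed trajectories

module Trajectories {m n : ℕ} (k : ℕ) {A : Set} (agents : List A) (∈-agents : ∀ a → a ∈ agents)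
                    (pos : A → ℕ → Vtx m n) where

  Reached : ℕ → Vtx m n → Set
  Reached s u = ∃ λ a → ∃ λ s′ → s′ ≤ s × pos a s′ ≡ u

  layout : List (Vtx m n)
  layout = map (λ a → pos a 0) agents

  searchersAt : ℕ → List (Searcher m n)
  searchersAt s = map (λ a → pos a s , s) agents

  protectedAt : ℕ → Vtx m n → Bool
  protectedAt zero    = proj₂ (initState layout)
  protectedAt (suc s) = newProt (protectedAt s) (searchersAt (suc s))

  stateAt : ℕ → State m n
  stateAt s = searchersAt s , protectedAt s

  initState≡stateAt0 : initState layout ≡ stateAt 0
  initState≡stateAt0 = cong (_, protectedAt 0) (sym (map-∘ agents))

  protectedAt⇒Reached : ∀ s u → protectedAt s u ≡ true → Reached s u
  protectedAt⇒Reached zero u prot with a , _ , refl ← any-eqV-map⇒∈ id _ agents prot = a , 0 , z≤n , refl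
  protectedAt⇒Reached (suc s) u prot with protectedAt s u in old
  ... | true  = let a , s′ , s′≤s , at-u = protectedAt⇒Reached s u old
                in a , s′ , m≤n⇒m≤1+n s′≤s , at-u
  ... | false with a , _ , refl ← any-eqV-map⇒∈ proj₁ _ agents prot = a , suc s , ≤-refl , refl

  Reached⇒protectedAt : ∀ s u → Reached s u → protectedAt s u ≡ true
  Reached⇒protectedAt zero    _ (a , _ , z≤n , refl) = ∈⇒any-eqV id (∈-map⁺ _ (∈-agents a))
  Reached⇒protectedAt (suc s) _ (a , s′ , s′≤1+s , refl) with m≤n⇒m<n∨m≡n s′≤1+s
  ... | inj₁ s′≤s = cong (_∨ _) (Reached⇒protectedAt s _ (a , s′ , s≤s⁻¹ s′≤s , refl))
  ... | inj₂ refl = trans (cong (protectedAt s (pos a (suc s)) ∨_)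
                                (∈⇒any-eqV proj₁ (∈-map⁺ _ (∈-agents a))))
                          (∨-zeroʳ _)

  unprotected⇒¬Reached : ∀ s u → protectedAt s u ≡ false → ¬ Reached s u
  unprotected⇒¬Reached s u unprot reached with () ← trans (sym unprot) (Reached⇒protectedAt s u reached)

  ¬Reached⇒unprotected : ∀ s u → ¬ Reached s u → protectedAt s u ≡ false
  ¬Reached⇒unprotected s u unreached with protectedAt s u in prot
  ... | true  = contradiction (protectedAt⇒Reached s u prot) unreached
  ... | false = refl

  module _ (moves-along  : ∀ a s → s < k → adj (pos a s) (pos a (suc s)) ≡ true)
           (moves-fresh  : ∀ a s → s < k → ¬ Reached s (pos a (suc s)))
           (moves-forced : ∀ a s u → s < k → adj (pos a s) u ≡ true → ¬ Reached s u → u ≡ pos a (suc s))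
           (reaches-all  : ∀ u → Reached k u) where

    unprotected-neighbours≡1 : ∀ a s → s < k → length (unprot (protectedAt s) (pos a s)) ≡ 1
    unprotected-neighbours≡1 a s s<k = length-filterᵇ≡1 _ (verts-unique m n) (∈-verts (pos a (suc s)))
      (cong₂ _∧_ (moves-along a s s<k) (cong not (¬Reached⇒unprotected s _ (moves-fresh a s s<k))))
      only-next
      where
      only-next : ∀ u → adj (pos a s) u ∧ not (protectedAt s u) ≡ true → u ≡ pos a (suc s)
      only-next u candidate = let adj-u , unprot-u = unprotected-neighbour⁻ {P = protectedAt s} candidate
                              in moves-forced a s u s<k adj-u (unprotected⇒¬Reached s u unprot-u)

    fires-on-trajectory : ∀ a s → s < k → fires k (stateAt s) (pos a s) ≡ true
    fires-on-trajectory a s s<k rewrite unprotected-neighbours≡1 a s s<k =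
      to T-≡ (≤⇒≤ᵇ (filter-some _ (lose (∈-map⁺ _ (∈-agents a))
                                       (from T-≡ (cong₂ _∧_ (eqV-refl (pos a s)) (to T-≡ (<⇒<ᵇ s<k)))))))

    agent-moves : ∀ a s → s < k → SMove k (stateAt s) (pos a s , s) (pos a (suc s) , suc s)
    agent-moves a s s<k =
      smove⁺ {k = k} {ps = searchersAt s} (cong₂ _∧_ (to T-≡ (<⇒<ᵇ s<k)) (fires-on-trajectory a s s<k))
             (moves-along a s s<k) (¬Reached⇒unprotected s _ (moves-fresh a s s<k))

    stage : ∀ s → s < k → Step k (stateAt s) (stateAt (suc s))
    stage s s<k = step (searchersAt (suc s)) (Pointwise.map⁺ _ _ (Pointwise.refl (agent-moves _ s s<k))) served
      where
      served : ∀ v u → fires k (stateAt s) v ≡ true → u ∈ unprot (protectedAt s) v →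
               Any (λ ss → proj₁ (proj₁ ss) ≡ v × proj₁ (proj₂ ss) ≡ u × mobile k (proj₁ ss) ≡ true)
                   (zip (searchersAt s) (searchersAt (suc s)))
      served v u fires-v u∈unprot
        with e , e∈ , at-v∧mobile ← 0<length-filterᵇ⇒∃ (λ e → eqV (proj₁ e) v ∧ mobile k e)
                                      (searchersAt s) (fires⇒0<nMobile {k = k} {st = stateAt s} fires-v)
        with a , _ , refl ← ∈-map⁻ _ e∈
        with refl ← eqV⇒≡ {u = pos a s} {v} (∧-conicalˡ _ _ at-v∧mobile)
        with adj-u , unprot-u ← ∈-unprot⁻ (protectedAt s) u∈unprot
        with refl ← moves-forced a s u s<k adj-u (unprotected⇒¬Reached s u unprot-u)
        = lose (∈-zip-map _ _ (∈-agents a)) (refl , refl , to T-≡ (<⇒<ᵇ s<k))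

    stages : ∀ s → s ≤ k → Star (Step k) (stateAt 0) (stateAt s)
    stages zero    _   = ε
    stages (suc s) s<k = stages s (<⇒≤ s<k) ◅◅ stage s s<k ◅ ε

    layout-successful : Successful k m n layout
    layout-successful = stateAt k
                      , subst (λ st → Star (Step k) st (stateAt k)) (sym initState≡stateAt0) (stages k ≤-refl)
                      , λ u → Reached⇒protectedAt k u (reaches-all u)

-- Alternating sweeps of a path cut into blocks

[b*d+o]%d≡o : ∀ b {d o} .{{_ : NonZero d}} → o < d → (b * d + o) % d ≡ o
[b*d+o]%d≡o b {d} {o} o<d =
  trans (cong (_% d) (+-comm (b * d) o)) (trans ([m+kn]%n≡m%n o b d) (m<n⇒m%n≡m o<d))

divMod-unique : ∀ {b b′ d o o′} .{{_ : NonZero d}} → o < d → o′ < d →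
                b * d + o ≡ b′ * d + o′ → b ≡ b′ × o ≡ o′
divMod-unique {b} {b′} {d} o<d o′<d eq =
  *-cancelʳ-≡ b b′ d (+-cancelʳ-≡ _ _ _ (trans eq (cong (b′ * d +_) (sym o≡o′)))) , o≡o′
  where
  o≡o′ = trans (sym ([b*d+o]%d≡o b o<d)) (trans (cong (_% d) eq) ([b*d+o]%d≡o b′ o′<d))

forward : ℕ → Bool
forward zero    = true
forward (suc b) = not (forward b)

direction : ∀ b → forward b ≡ true ⊎ forward b ≡ false
direction b with forward b
... | true  = inj₁ refl
... | false = inj₂ refl

module BlockSweep (k : ℕ) where

  -- Clamping at k keeps every position inside its block; only s ≤ k is ever used.
  offset : Bool → ℕ → ℕ
  offset true  s = s ⊓ k
  offset false s = k ∸ s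

  sweep : ℕ → ℕ → ℕ
  sweep b s = b * suc k + offset (forward b) s

  Swept : ℕ → ℕ → ℕ → Set
  Swept q s i = ∃ λ b → ∃ λ s′ → b < q × s′ ≤ s × sweep b s′ ≡ i

  offset≤k : ∀ d s → offset d s ≤ k
  offset≤k true  s = m⊓n≤n s k
  offset≤k false s = m∸n≤m k s

  offset-injective : ∀ d {s s′} → s ≤ k → s′ ≤ k → offset d s ≡ offset d s′ → s ≡ s′
  offset-injective true  s≤k s′≤k eq = trans (sym (m≤n⇒m⊓n≡m s≤k)) (trans eq (m≤n⇒m⊓n≡m s′≤k))
  offset-injective false s≤k s′≤k eq = ∸-cancelˡ-≡ s≤k s′≤k eq

  sweep-forward : ∀ b {s} → forward b ≡ true → s ≤ k → sweep b s ≡ b * suc k + s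
  sweep-forward b dir s≤k rewrite dir = cong (b * suc k +_) (m≤n⇒m⊓n≡m s≤k)

  sweep-backward : ∀ b {s} → forward b ≡ false → sweep b s ≡ b * suc k + (k ∸ s)
  sweep-backward b dir rewrite dir = refl

  sweep<q*[1+k] : ∀ {q b} s → b < q → sweep b s < q * suc k
  sweep<q*[1+k] {q} {b} s b<q = begin-strict
    b * suc k + offset (forward b) s  <⟨ +-monoʳ-< (b * suc k) (s≤s (offset≤k (forward b) s)) ⟩
    b * suc k + suc k                 ≡⟨ +-comm (b * suc k) (suc k) ⟩
    suc b * suc k                     ≤⟨ *-monoˡ-≤ (suc k) b<q ⟩
    q * suc k                         ∎
    where open ≤-Reasoning

  block<q : ∀ {q} b s → sweep b s < q * suc k → b < q
  block<q {q} b s sweep< = *-cancelʳ-< (suc k) b q (≤-<-trans (m≤m+n (b * suc k) _) sweep<)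

  sweep-injective : ∀ {b b′ s s′} → s ≤ k → s′ ≤ k → sweep b s ≡ sweep b′ s′ → b ≡ b′ × s ≡ s′
  sweep-injective {b} {b′} {s} {s′} s≤k s′≤k eq
    with refl , offsets ← divMod-unique {b} {b′} (s≤s (offset≤k (forward b) s))
                                                 (s≤s (offset≤k (forward b′) s′)) eq
    = refl , offset-injective (forward b) s≤k s′≤k offsets

  sweep-forward-step : ∀ b {s} → forward b ≡ true → s < k → suc (sweep b s) ≡ sweep b (suc s)
  sweep-forward-step b {s} dir s<k = begin
    suc (sweep b s)      ≡⟨ cong suc (sweep-forward b dir (<⇒≤ s<k)) ⟩
    suc (b * suc k + s)  ≡⟨ +-suc (b * suc k) s ⟨
    b * suc k + suc s    ≡⟨ sweep-forward b dir s<k ⟨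
    sweep b (suc s)      ∎
    where open ≡-Reasoning

  sweep-backward-step : ∀ b {s} → forward b ≡ false → s < k → suc (sweep b (suc s)) ≡ sweep b s
  sweep-backward-step b {s} dir s<k = begin
    suc (sweep b (suc s))          ≡⟨ cong suc (sweep-backward b dir) ⟩
    suc (b * suc k + (k ∸ suc s))  ≡⟨ +-suc (b * suc k) _ ⟨
    b * suc k + suc (k ∸ suc s)    ≡⟨ cong (b * suc k +_) (+-∸-assoc 1 s<k) ⟨
    b * suc k + (k ∸ s)            ≡⟨ sweep-backward b dir ⟨
    sweep b s                      ∎
    where open ≡-Reasoning

  backward-start+1≡next-start : ∀ b → forward b ≡ false → suc (sweep b 0) ≡ sweep (suc b) 0
  backward-start+1≡next-start b dir = begin
    suc (sweep b 0)      ≡⟨ cong suc (sweep-backward b dir) ⟩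
    suc (b * suc k + k)  ≡⟨ cong suc (+-comm (b * suc k) k) ⟩
    suc b * suc k        ≡⟨ +-identityʳ (suc b * suc k) ⟨
    suc b * suc k + 0    ≡⟨ sweep-forward (suc b) (cong not dir) z≤n ⟨
    sweep (suc b) 0      ∎
    where open ≡-Reasoning

  sweep-step : ∀ b {s} → s < k → dist1 (sweep b s) (sweep b (suc s)) ≡ true
  sweep-step b s<k with direction b
  ... | inj₁ dir = dist1⁺ (inj₁ (sweep-forward-step b dir s<k))
  ... | inj₂ dir = dist1⁺ (inj₂ (sweep-backward-step b dir s<k))

  sweep-neighbour : ∀ {q} b {s i} → b < q → s < k → i < q * suc k → dist1 (sweep b s) i ≡ true →
                    i ≡ sweep b (suc s) ⊎ Swept q s i
  sweep-neighbour b {s} {i} b<q s<k i<q*[1+k] close with direction b | dist1⁻ _ _ close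
  ... | inj₁ dir | inj₁ up   = inj₁ (trans (sym up) (sweep-forward-step b dir s<k))
  ... | inj₂ dir | inj₂ down = inj₁ (suc-injective (trans down (sym (sweep-backward-step b dir s<k))))
  sweep-neighbour b {suc s} b<q s<k _ _ | inj₁ dir | inj₂ down =
    inj₂ (b , s , b<q , n≤1+n s , suc-injective (trans (sweep-forward-step b dir (<-trans (n<1+n s) s<k)) (sym down)))
  sweep-neighbour zero    {zero} _ _ _ _ | inj₁ _ | inj₂ ()
  sweep-neighbour (suc b) {zero} b<q _ _ _ | inj₁ dir | inj₂ down =
    inj₂ (b , 0 , <-trans (n<1+n b) b<q , z≤n ,
          suc-injective (trans (backward-start+1≡next-start b (to T-not-≡ (from T-≡ dir))) (sym down)))
  sweep-neighbour b {suc s} b<q s<k _ _ | inj₂ dir | inj₁ refl =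
    inj₂ (b , s , b<q , n≤1+n s , sym (sweep-backward-step b dir (<-trans (n<1+n s) s<k)))
  sweep-neighbour {q} b {zero} _ _ i<q*[1+k] _ | inj₂ dir | inj₁ refl =
    inj₂ (suc b , 0 , block<q (suc b) 0 (subst (_< q * suc k) next i<q*[1+k]) , z≤n , sym next)
    where next = backward-start+1≡next-start b dir

  sweep-covers : ∀ {q i} → i < q * suc k → Swept q k i
  sweep-covers {q} {i} i<q*[1+k] = cover (direction b)
    where
    b = i / suc k
    o = i % suc k
    o≤k : o ≤ k
    o≤k = s≤s⁻¹ (m%n<n i (suc k))
    i≡b*[1+k]+o : i ≡ b * suc k + o
    i≡b*[1+k]+o = trans (m≡m%n+[m/n]*n i (suc k)) (+-comm o (b * suc k))
    cover : forward b ≡ true ⊎ forward b ≡ false → Swept q k i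
    cover (inj₁ dir) = b , o , m<n*o⇒m/o<n i<q*[1+k] , o≤k ,
      trans (sweep-forward b dir o≤k) (sym i≡b*[1+k]+o)
    cover (inj₂ dir) = b , k ∸ o , m<n*o⇒m/o<n i<q*[1+k] , m∸n≤m k o ,
      trans (sweep-backward b dir) (trans (cong (b * suc k +_) (m∸[m∸n]≡n o≤k)) (sym i≡b*[1+k]+o))

-- Sweeping the grid line by line

-- at x j is the vertex at position x of the j-th line; the lines run along either coordinate.
module GridSweep (k q w : ℕ) {m n : ℕ} (at : Fin (q * suc k) → Fin w → Vtx m n)
  (at-onto       : ∀ u → ∃ λ x → ∃ λ j → at x j ≡ u)
  (at-injectiveˡ : ∀ {x x′ j j′} → at x j ≡ at x′ j′ → x ≡ x′)
  (adj-along     : ∀ {x x′} j → dist1 (toℕ x) (toℕ x′) ≡ true → adj (at x j) (at x′ j) ≡ true)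
  (adj-at⁻       : ∀ {x x′ j j′} → adj (at x j) (at x′ j′) ≡ true →
                   (dist1 (toℕ x) (toℕ x′) ≡ true × j ≡ j′) ⊎ x ≡ x′)
  where

  open BlockSweep k

  line : Fin q → ℕ → Fin (q * suc k)
  line b s = fromℕ< (sweep<q*[1+k] s (toℕ<n b))

  toℕ-line : ∀ b s → toℕ (line b s) ≡ sweep (toℕ b) s
  toℕ-line b s = toℕ-fromℕ< _

  agents : List (Fin q × Fin w)
  agents = cartesianProduct (allFin q) (allFin w)

  pos : Fin q × Fin w → ℕ → Vtx m n
  pos (b , j) s = at (line b s) j

  open Trajectories k agents (λ (b , j) → ∈-cartesianProduct⁺ (∈-allFin b) (∈-allFin j)) pos public

  swept⇒Reached : ∀ {s x} j → Swept q s (toℕ x) → Reached s (at x j)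
  swept⇒Reached j (b , s′ , b<q , s′≤s , swept) = (fromℕ< b<q , j) , s′ , s′≤s , cong (λ x → at x j)
    (toℕ-injective (trans (toℕ-line (fromℕ< b<q) s′)
                          (trans (cong (λ c → sweep c s′) (toℕ-fromℕ< b<q)) swept)))

  moves-along : ∀ a s → s < k → adj (pos a s) (pos a (suc s)) ≡ true
  moves-along (b , j) s s<k = adj-along j
    (subst₂ (λ x y → dist1 x y ≡ true) (sym (toℕ-line b s)) (sym (toℕ-line b (suc s)))
            (sweep-step (toℕ b) s<k))

  moves-fresh : ∀ a s → s < k → ¬ Reached s (pos a (suc s))
  moves-fresh (b , j) s s<k ((b′ , _) , s′ , s′≤s , same) = <⇒≱ (s≤s s′≤s) (≤-reflexive (sym s′≡1+s))
    where
    s′≡1+s : s′ ≡ suc s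
    s′≡1+s = proj₂ (sweep-injective {toℕ b′} {toℕ b} (≤-trans s′≤s (<⇒≤ s<k)) s<k
      (trans (sym (toℕ-line b′ s′)) (trans (cong toℕ (at-injectiveˡ same)) (toℕ-line b (suc s)))))

  line-neighbour : ∀ b s {x} → s < k → dist1 (toℕ (line b s)) (toℕ x) ≡ true →
                   x ≡ line b (suc s) ⊎ Swept q s (toℕ x)
  line-neighbour b s {x} s<k close =
    Sum.map₁ (λ next → toℕ-injective (trans next (sym (toℕ-line b (suc s)))))
             (sweep-neighbour (toℕ b) (toℕ<n b) s<k (toℕ<n x)
                              (subst (λ y → dist1 y (toℕ x) ≡ true) (toℕ-line b s) close))

  moves-forced : ∀ a s u → s < k → adj (pos a s) u ≡ true → ¬ Reached s u → u ≡ pos a (suc s)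
  moves-forced (b , j) s u s<k close unreached with x , j′ , refl ← at-onto u | adj-at⁻ close
  ... | inj₂ refl = contradiction ((b , j′) , s , ≤-refl , refl) unreached
  ... | inj₁ (close′ , refl) with line-neighbour b s s<k close′
  ...   | inj₁ refl  = refl
  ...   | inj₂ swept = contradiction (swept⇒Reached j swept) unreached

  reaches-all : ∀ u → Reached k u
  reaches-all u with x , j , refl ← at-onto u = swept⇒Reached j (sweep-covers (toℕ<n x))

  successful : Successful k m n layout
  successful = layout-successful moves-along moves-fresh moves-forced reaches-all

  length-layout : length layout ≡ q * w
  length-layout = begin
    length (map (λ a → pos a 0) agents)    ≡⟨ length-map _ agents ⟩
    length agents                          ≡⟨ length-cartesianProduct (allFin q) (allFin w) ⟩
    length (allFin q) * length (allFin w)  ≡⟨ cong₂ _*_ (length-allFin q) (length-allFin w) ⟩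
    q * w                                  ∎
    where open ≡-Reasoning

module VerticalSweep (k q n : ℕ) = GridSweep k q n {q * suc k} {n} _,_
  (λ u → proj₁ u , proj₂ u , refl) (cong proj₁) (λ {x} {x′} j → adj-vertical {i = x} {x′} j) adj-vertical⁻

module HorizontalSweep (k q m : ℕ) = GridSweep k q m {m} {q * suc k} (λ x i → i , x)
  (λ u → proj₂ u , proj₁ u , refl) (cong proj₂) (λ {x} {x′} i → adj-horizontal i {x} {x′}) adj-horizontal⁻

perfect-layout⇒deduction-number : (L : List (Vtx m n)) → Successful k m n L → length L * suc k ≡ m * n →
                                  IsDeductionNumber k m n ((m * n) / suc k)
perfect-layout⇒deduction-number {k = k} L success perfect =
  (L , sym (trans (cong (_/ suc k) (sym perfect)) (m*n/n≡m (length L) (suc k))) , success) ,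
  successful⇒m*n/[k+1]≤length

corollary4p4 : (k m n : ℕ) → 1 ≤ k → 2 ≤ m → 2 ≤ n →
    (suc k ∣ m ⊎ suc k ∣ n) →
    IsDeductionNumber k m n ((m * n) / suc k)
corollary4p4 k _ n _ _ _ (inj₁ (divides q refl)) = perfect-layout⇒deduction-number layout successful
  (trans (cong (_* suc k) length-layout) (*-Properties.xy∙z≈xz∙y q n (suc k)))
  where open VerticalSweep k q n
corollary4p4 k m _ _ _ _ (inj₂ (divides q refl)) = perfect-layout⇒deduction-number layout successful
  (trans (cong (_* suc k) length-layout) (*-Properties.xy∙z≈y∙xz q m (suc k)))
  where open HorizontalSweep k q m
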